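{- Let $X$ be a robust $X$-set parameter and let $G$ be a graph. If $X(K_1)=0$ or $G$ has no isolated vertices, then the automorphism group of $\mathfrak{X}(G)$ is generated by $\{\nu_R : R\subseteq V(G)\text{ is } X\text{ -irrelevant}\}\cup M_X(G)$, where each $\psi\in M_X(G)$ is regarded as the map $S\mapsto\psi(S)$ on $X$-sets.
   Context: All graphs are finite, simple, undirected, with nonempty vertex set. A vertex set property assigns to each graph $G$ a family of subsets of $V(G)$ (the $X$-sets of $G$), invariant under graph isomorphism; it is cohesive if every graph has at least one $X$-set. A robust $X$-set parameter is a cohesive vertex set property satisfying: (Superset) if $S$ is an $X$-set of $G$ and $S\subseteq S'\subseteq V(G)$ then $S'$ is an $X$-set; ($(n-1)$-set) if $G$ is connected of order $n\ge 2$, every set of $n-1$ vertices is an $X$-set; (Component consistency) if $G_1,\dots,G_k$ are the connected components of $G$, then $S$ is an $X$-set of $G$ iff $S\cap V(G_i)$ is an $X$-set of $G_i$ for every $i$. $X(G)$ is the minimum cardinality of an $X$-set, $X(K_1)$ its value on the one-vertex graph. The $X$-TAR graph $\mathfrak{X}(G)$ has as vertices the $X$-sets of $G$, with $S_1,S_2$ adjacent iff $|S_1\ominus S_2|=1$. A vertex $v$ of $G$ is $X$-irrelevant if $v$ lies in no minimal (under inclusion) $X$-set of $G$; a set $R\subseteq V(G)$ is $X$-irrelevant if all its vertices are. For $R\subseteq V(G)$, $\nu_R$ is the map $S\mapsto S\ominus R$ on $X$-sets of $G$. $M_X(G)$ is the set of bijections $\psi:V(G)\to V(G)$ that send minimal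 $X$-sets of $G$ to minimal $X$-sets of $G$ of the same size. -}

module Defs where

open import Data.Nat using (ℕ; zero; suc; _≤_)
open import Data.Bool using (Bool; true; false; _xor_)
open import Data.Fin using (Fin)
open import Data.Fin.Subset using (Subset; _∈_; _∉_; _⊆_; ∣_∣; _∩_)
open import Data.Vec using (tabulate; lookup; zipWith)
open import Data.List using (List; []; _∷_; foldr)
open import Data.Product using (Σ; ∃; _×_; _,_)
open import Data.Sum using (_⊎_)
open import Function.Bundles using (_↔_; Inverse; _⇔_)
open import Relation.Binary.PropositionalEquality using (_≡_)

record Graph (n : ℕ) : Set where
  field
    adj    : Fin n → Fin n → Bool
    sym    : ∀ i j → adj i j ≡ adj j i
    irrefl : ∀ i → adj i i ≡ false
open Graph public

K₁ : Graph 1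
K₁ = record { adj = λ _ _ → false ; sym = λ _ _ → _≡_.refl ; irrefl = λ _ → _≡_.refl }

data Reach {n : ℕ} (G : Graph n) : Fin n → Fin n → Set where
  here : ∀ {u} → Reach G u u
  step : ∀ {u v w} → adj G u v ≡ true → Reach G v w → Reach G u w

Connected : ∀ {n} → Graph n → Set
Connected G = ∀ u v → Reach G u v

IsComponent : ∀ {n} → Graph n → Subset n → Set
IsComponent {n} G C = ∃ λ (v : Fin n) → ∀ u → (u ∈ C → Reach G v u) × (Reach G v u → u ∈ C)

-- H (on Fin k) is the subgraph of G induced on C, via the relabelling e
-- (e injective with image exactly C)
InducedOn : ∀ {n k} → Graph n → Subset n → Graph k → (Fin k → Fin n) → Set
InducedOn {n} {k} G C H e =
  (∀ i j → e i ≡ e j → i ≡ j) ×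
  (∀ u → u ∈ C → ∃ λ i → e i ≡ u) ×
  (∀ i → e i ∈ C) ×
  (∀ i j → adj H i j ≡ adj G (e i) (e j))

IsolatedVertex : ∀ {n} → Graph n → Fin n → Set
IsolatedVertex {n} G v = ∀ (u : Fin n) → adj G v u ≡ false

NoIsolatedVertices : ∀ {n} → Graph n → Set
NoIsolatedVertices G = ∀ v → IsolatedVertex G v → Data.Empty.⊥
  where import Data.Empty

image : ∀ {n m} → Fin n ↔ Fin m → Subset n → Subset m
image σ S = tabulate (λ j → lookup S (Inverse.from σ j))

preimage : ∀ {k n} → (Fin k → Fin n) → Subset n → Subset k
preimage e S = tabulate (λ i → lookup S (e i))

_⊖_ : ∀ {n} → Subset n → Subset n → Subset n
S ⊖ T = zipWith _xor_ S T

VertexSetProperty : Set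
VertexSetProperty = (n : ℕ) → Graph n → Subset n → Bool

module _ (X : VertexSetProperty) where

  IsXSet : ∀ {n} → Graph n → Subset n → Set
  IsXSet {n} G S = X n G S ≡ true

  IsoInvariant : Set
  IsoInvariant = ∀ n m → 1 ≤ n → (G : Graph n) (H : Graph m) (σ : Fin n ↔ Fin m) →
    (∀ i j → adj H (Inverse.to σ i) (Inverse.to σ j) ≡ adj G i j) →
    ∀ S → X n G S ≡ X m H (image σ S)

  Cohesive : Set
  Cohesive = ∀ n → 1 ≤ n → (G : Graph n) → ∃ λ S → IsXSet G S

  SupersetProp : Set
  SupersetProp = ∀ n → 1 ≤ n → (G : Graph n) → ∀ S S′ → IsXSet G S → S ⊆ S′ → IsXSet G S′

  N-1-SetProp : Set
  N-1-SetProp = ∀ n → 2 ≤ n → (G : Graph n) → Connected G →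
    ∀ S → suc ∣ S ∣ ≡ n → IsXSet G S

  ComponentConsistency : Set
  ComponentConsistency = ∀ n → 1 ≤ n → (G : Graph n) → ∀ S →
    IsXSet G S ⇔
      (∀ C → IsComponent G C → ∀ k (H : Graph k) (e : Fin k → Fin n) →
         InducedOn G C H e → IsXSet H (preimage e S))

  record RobustXSetParameter : Set where
    field
      isoInvariant : IsoInvariant
      cohesive     : Cohesive
      superset     : SupersetProp
      n-1-set      : N-1-SetProp
      componentConsistency : ComponentConsistency

  -- X(G) = k : k is the minimum cardinality of an X-set of G
  XNumber : ∀ {n} → Graph n → ℕ → Set
  XNumber G k = (∃ λ S → IsXSet G S × ∣ S ∣ ≡ k) × (∀ S → IsXSet G S → k ≤ ∣ S ∣)

  MinimalXSet : ∀ {n} → Graph n → Subset n → Set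
  MinimalXSet G S = IsXSet G S × (∀ T → T ⊆ S → IsXSet G T → T ≡ S)

  IrrelevantVertex : ∀ {n} → Graph n → Fin n → Set
  IrrelevantVertex G v = ∀ S → MinimalXSet G S → v ∉ S

  IrrelevantSet : ∀ {n} → Graph n → Subset n → Set
  IrrelevantSet G R = ∀ v → v ∈ R → IrrelevantVertex G v

  InMX : ∀ {n} → Graph n → Fin n ↔ Fin n → Set
  InMX G ψ = ∀ S → MinimalXSet G S → MinimalXSet G (image ψ S) × ∣ image ψ S ∣ ≡ ∣ S ∣

  TARAdj : ∀ {n} → Subset n → Subset n → Set
  TARAdj S T = ∣ S ⊖ T ∣ ≡ 1

  -- f (restricted to X-sets) is an automorphism of the X-TAR graph 𝔛(G)
  record IsTARAut {n} (G : Graph n) (f : Subset n → Subset n) : Set where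
    field
      maps    : ∀ S → IsXSet G S → IsXSet G (f S)
      inv     : Subset n → Subset n
      invMaps : ∀ S → IsXSet G S → IsXSet G (inv S)
      invˡ    : ∀ S → IsXSet G S → inv (f S) ≡ S
      invʳ    : ∀ S → IsXSet G S → f (inv S) ≡ S
      adjPres : ∀ S T → IsXSet G S → IsXSet G T → TARAdj S T ⇔ TARAdj (f S) (f T)

  -- generators: ν_R (R X-irrelevant), ψ ∈ M_X(G), and inverses ψ⁻¹
  -- (ν_R is an involution, so it is its own inverse)
  data Generator {n} (G : Graph n) : Set where
    ν   : (R : Subset n) → IrrelevantSet G R → Generator G
    ψ⁺  : (ψ : Fin n ↔ Fin n) → InMX G ψ → Generator G
    ψ⁻  : (ψ : Fin n ↔ Fin n) → InMX G ψ → Generator G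

  applyGen : ∀ {n} {G : Graph n} → Generator G → Subset n → Subset n
  applyGen (ν R _)   S = S ⊖ R
  applyGen (ψ⁺ ψ _)  S = image ψ S
  applyGen (ψ⁻ ψ _)  S = tabulate (λ j → lookup S (Inverse.to ψ j))

  evalWord : ∀ {n} {G : Graph n} → List (Generator G) → Subset n → Subset n
  evalWord w S = foldr applyGen S w

-- The X-sets of G form an up-closed family of vertices of the hypercube on subsets of V(G), and
-- under the hypothesis it contains V(G) and every V(G) ∖ {x}. An automorphism f of 𝔛(G) sends an
-- edge S — S ∪ {x} to an edge whose direction π x does not depend on S: the four X-sets
-- S, S ∪ {x}, S ∪ {x, y}, S ∪ {y} form a 4-cycle, and opposite edges of a 4-cycle in a hypercube
-- are parallel. The same argument for f⁻¹ inverts π, and inducting down from V(G) gives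
-- f S = π(S) ⊖ T with T = V(G) ∖ f(V(G)). If some t ∈ T lay in a minimal X-set M, toggling π⁻¹ t
-- in f⁻¹(M) would produce the X-set M ∖ {t}; so T is X-irrelevant, and then π ∈ M_X(G).
-- Conversely ν_R and ψ ∈ M_X(G) preserve X-sets because every X-set contains a minimal one.

module Submission where

open import Defs renaming (sym to adj-sym)
open import Data.Bool using (Bool; true; false; not; _xor_)
open import Data.Bool.Properties using (xor-assoc; xor-comm; xor-identityˡ; xor-identityʳ; xor-same; true-xor) renaming (_≟_ to _≟ᵇ_)
open import Data.Fin using (Fin; zero; suc; toℕ; combine)
open import Data.Fin.Properties using (_≟_; any?; pigeonhole; combine-injective)
open import Data.Fin.Subset using (Subset; _∈_; _∉_; _⊆_; _⊂_; ∣_∣; ⁅_⁆; ∁; ⊤; ⊥)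
open import Data.Fin.Subset.Properties
  using (_∈?_; x∈⁅x⁆; x∈⁅y⁆⇒x≡y; x≢y⇒x∉⁅y⁆; x∉⁅y⁆⇒x≢y; ∣⁅x⁆∣≡1; ∣∁p∣≡n∸∣p∣; ∈⊤; ⊆⊤; ⊆-antisym; x∉p⇒x∈∁p; x∈∁p⇒x∉p; anySubset?; _⊂?_; ⊥⊆)
open import Data.Fin.Subset.Induction using (⊃-wellFounded; ⊂-wellFounded)
open import Data.List using (List; []; _∷_)
open import Data.Nat using (ℕ; zero; suc; _+_; _∸_; _^_; _≤_; z≤n; s≤s)
open import Data.Nat.GeneralisedArithmetic using (iterate)
open import Data.Nat.Properties using (n<1+n; +-comm; m≤n⇒∃[o]m+o≡n; suc-injective; +-0-commutativeMonoid)
open import Algebra.Properties.CommutativeMonoid.Sum +-0-commutativeMonoid using (sum; sum-permute; sum-cong-≗)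
open import Data.Product using (∃; _×_; _,_; proj₁; proj₂)
open import Data.Sum using (_⊎_; inj₁; inj₂)
open import Data.Vec using ([]; _∷_; lookup)
open import Data.Vec.Properties
  using (lookup∘tabulate; tabulate∘lookup; tabulate-cong; lookup-zipWith; lookup-map; lookup-replicate;
         []=⇒lookup; lookup⇒[]=; zipWith-assoc; zipWith-comm; zipWith-identityˡ; zipWith-identityʳ)
open import Function using (_∘_; case_of_)
open import Function.Bundles using (_↔_; Inverse; _⇔_; mk⇔; mk↔ₛ′; Equivalence)
open import Function.Construct.Symmetry using (↔-sym)
open import Function.Construct.Identity using (↔-id)
open import Induction.WellFounded using (module All)
open import Relation.Nullary using (¬_; yes; no; contradiction)
open import Relation.Nullary.Decidable using (¬?; _×-dec_)
open import Relation.Binary.PropositionalEquality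
open ≡-Reasoning

-- Symmetric difference and the hypercube

module _ {n : ℕ} where

  lookup-ext : {S T : Subset n} → (∀ i → lookup S i ≡ lookup T i) → S ≡ T
  lookup-ext {S} {T} eq = trans (sym (tabulate∘lookup S)) (trans (tabulate-cong eq) (tabulate∘lookup T))

  lookup-⊖ : ∀ (S T : Subset n) i → lookup (S ⊖ T) i ≡ lookup S i xor lookup T i
  lookup-⊖ S T i = lookup-zipWith _xor_ i S T

  ∉⇒lookup≡false : ∀ {S : Subset n} {i} → i ∉ S → lookup S i ≡ false
  ∉⇒lookup≡false {S} {i} i∉S with lookup S i in eq
  ... | true  = contradiction (lookup⇒[]= i S eq) i∉S
  ... | false = refl

  lookup≡false⇒∉ : ∀ {S : Subset n} {i} → lookup S i ≡ false → i ∉ S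
  lookup≡false⇒∉ eq i∈S with trans (sym eq) ([]=⇒lookup i∈S)
  ... | ()

  ⊖-assoc : ∀ (S T R : Subset n) → (S ⊖ T) ⊖ R ≡ S ⊖ (T ⊖ R)
  ⊖-assoc = zipWith-assoc xor-assoc

  ⊖-comm : ∀ (S T : Subset n) → S ⊖ T ≡ T ⊖ S
  ⊖-comm = zipWith-comm xor-comm

  ⊖-identityˡ : ∀ (S : Subset n) → ⊥ ⊖ S ≡ S
  ⊖-identityˡ = zipWith-identityˡ xor-identityˡ

  ⊖-identityʳ : ∀ (S : Subset n) → S ⊖ ⊥ ≡ S
  ⊖-identityʳ = zipWith-identityʳ xor-identityʳ

  ⊖-self : ∀ (S : Subset n) → S ⊖ S ≡ ⊥
  ⊖-self S = lookup-ext λ i → trans (lookup-⊖ S S i) (trans (xor-same (lookup S i)) (sym (lookup-replicate i false)))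

  ∁≡⊤⊖ : ∀ (S : Subset n) → ∁ S ≡ ⊤ ⊖ S
  ∁≡⊤⊖ S = lookup-ext λ i → begin
    lookup (∁ S) i               ≡⟨ lookup-map i not S ⟩
    not (lookup S i)             ≡⟨ true-xor (lookup S i) ⟨
    true xor lookup S i          ≡⟨ cong (_xor lookup S i) (lookup-replicate i true) ⟨
    lookup ⊤ i xor lookup S i    ≡⟨ lookup-⊖ ⊤ S i ⟨
    lookup (⊤ ⊖ S) i             ∎

  ⊖-cancelʳ : ∀ (S R : Subset n) → (S ⊖ R) ⊖ R ≡ S
  ⊖-cancelʳ S R = begin
    (S ⊖ R) ⊖ R  ≡⟨ ⊖-assoc S R R ⟩
    S ⊖ (R ⊖ R)  ≡⟨ cong (S ⊖_) (⊖-self R) ⟩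
    S ⊖ ⊥        ≡⟨ ⊖-identityʳ S ⟩
    S            ∎

  ⊖-cancelˡ : ∀ (R S : Subset n) → R ⊖ (R ⊖ S) ≡ S
  ⊖-cancelˡ R S = begin
    R ⊖ (R ⊖ S)  ≡⟨ ⊖-assoc R R S ⟨
    (R ⊖ R) ⊖ S  ≡⟨ cong (_⊖ S) (⊖-self R) ⟩
    ⊥ ⊖ S        ≡⟨ ⊖-identityˡ S ⟩
    S            ∎

  ⊖-injectiveˡ : ∀ (R : Subset n) {S T} → R ⊖ S ≡ R ⊖ T → S ≡ T
  ⊖-injectiveˡ R {S} {T} eq = trans (sym (⊖-cancelˡ R S)) (trans (cong (R ⊖_) eq) (⊖-cancelˡ R T))

  ⊖≡⇒≡⊖ : ∀ {S T D : Subset n} → S ⊖ T ≡ D → T ≡ S ⊖ D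
  ⊖≡⇒≡⊖ {S} {T} eq = trans (sym (⊖-cancelˡ S T)) (cong (S ⊖_) eq)

  ⊖≡⊥⇒≡ : ∀ {S T : Subset n} → S ⊖ T ≡ ⊥ → S ≡ T
  ⊖≡⊥⇒≡ {S} {T} eq = sym (trans (⊖≡⇒≡⊖ eq) (⊖-identityʳ S))

  ⊖-chain : ∀ (S T R : Subset n) → (S ⊖ T) ⊖ (T ⊖ R) ≡ S ⊖ R
  ⊖-chain S T R = begin
    (S ⊖ T) ⊖ (T ⊖ R)  ≡⟨ ⊖-assoc S T (T ⊖ R) ⟩
    S ⊖ (T ⊖ (T ⊖ R))  ≡⟨ cong (S ⊖_) (⊖-cancelˡ T R) ⟩
    S ⊖ R              ∎

  ⊖-swapʳ : ∀ (S T R : Subset n) → (S ⊖ T) ⊖ R ≡ (S ⊖ R) ⊖ T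
  ⊖-swapʳ S T R = begin
    (S ⊖ T) ⊖ R  ≡⟨ ⊖-assoc S T R ⟩
    S ⊖ (T ⊖ R)  ≡⟨ cong (S ⊖_) (⊖-comm T R) ⟩
    S ⊖ (R ⊖ T)  ≡⟨ ⊖-assoc S R T ⟨
    (S ⊖ R) ⊖ T  ∎

  ⁅⁆-injective : ∀ {x y : Fin n} → ⁅ x ⁆ ≡ ⁅ y ⁆ → x ≡ y
  ⁅⁆-injective {x} {y} eq = x∈⁅y⁆⇒x≡y y (subst (x ∈_) eq (x∈⁅x⁆ x))

  lookup-⊖⁅x⁆-x : ∀ (S : Subset n) x → lookup (S ⊖ ⁅ x ⁆) x ≡ not (lookup S x)
  lookup-⊖⁅x⁆-x S x = begin
    lookup (S ⊖ ⁅ x ⁆) x          ≡⟨ lookup-⊖ S ⁅ x ⁆ x ⟩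
    lookup S x xor lookup ⁅ x ⁆ x ≡⟨ cong (lookup S x xor_) ([]=⇒lookup (x∈⁅x⁆ x)) ⟩
    lookup S x xor true           ≡⟨ xor-comm (lookup S x) true ⟩
    true xor lookup S x           ≡⟨ true-xor (lookup S x) ⟩
    not (lookup S x)              ∎

  lookup-⊖⁅x⁆-≢ : ∀ (S : Subset n) {x i} → i ≢ x → lookup (S ⊖ ⁅ x ⁆) i ≡ lookup S i
  lookup-⊖⁅x⁆-≢ S {x} {i} i≢x = begin
    lookup (S ⊖ ⁅ x ⁆) i           ≡⟨ lookup-⊖ S ⁅ x ⁆ i ⟩
    lookup S i xor lookup ⁅ x ⁆ i  ≡⟨ cong (lookup S i xor_) (∉⇒lookup≡false (x≢y⇒x∉⁅y⁆ i≢x)) ⟩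
    lookup S i xor false           ≡⟨ xor-identityʳ (lookup S i) ⟩
    lookup S i                     ∎

  ∈-⊖⁅⁆⁺ : ∀ {S : Subset n} {x i} → i ≢ x → i ∈ S → i ∈ S ⊖ ⁅ x ⁆
  ∈-⊖⁅⁆⁺ {S} {x} {i} i≢x i∈S = lookup⇒[]= i _ (trans (lookup-⊖⁅x⁆-≢ S i≢x) ([]=⇒lookup i∈S))

  ∈-⊖⁅⁆⁻ : ∀ {S : Subset n} {x i} → i ≢ x → i ∈ S ⊖ ⁅ x ⁆ → i ∈ S
  ∈-⊖⁅⁆⁻ {S} {x} {i} i≢x i∈ = lookup⇒[]= i S (trans (sym (lookup-⊖⁅x⁆-≢ S i≢x)) ([]=⇒lookup i∈))

  x∈S⊖⁅x⁆ : ∀ {S : Subset n} {x} → x ∉ S → x ∈ S ⊖ ⁅ x ⁆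
  x∈S⊖⁅x⁆ {S} {x} x∉S = lookup⇒[]= x _ (trans (lookup-⊖⁅x⁆-x S x) (cong not (∉⇒lookup≡false x∉S)))

  x∉S⊖⁅x⁆ : ∀ {S : Subset n} {x} → x ∈ S → x ∉ S ⊖ ⁅ x ⁆
  x∉S⊖⁅x⁆ {S} {x} x∈S = lookup≡false⇒∉ (trans (lookup-⊖⁅x⁆-x S x) (cong not ([]=⇒lookup x∈S)))

  ⊆-⊖⁅⁆ : ∀ {S : Subset n} {x} → x ∉ S → S ⊆ S ⊖ ⁅ x ⁆
  ⊆-⊖⁅⁆ x∉S i∈S = ∈-⊖⁅⁆⁺ (λ { refl → x∉S i∈S }) i∈S

  ⊂-⊖⁅⁆ : ∀ {S : Subset n} {x} → x ∉ S → S ⊂ S ⊖ ⁅ x ⁆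
  ⊂-⊖⁅⁆ {x = x} x∉S = ⊆-⊖⁅⁆ x∉S , x , x∈S⊖⁅x⁆ x∉S , x∉S

  ∈-⊖-both : ∀ {S T : Subset n} {i} → i ∈ S → i ∈ T → i ∉ S ⊖ T
  ∈-⊖-both {S} {T} {i} i∈S i∈T = lookup≡false⇒∉ (begin
    lookup (S ⊖ T) i           ≡⟨ lookup-⊖ S T i ⟩
    lookup S i xor lookup T i  ≡⟨ cong₂ _xor_ ([]=⇒lookup i∈S) ([]=⇒lookup i∈T) ⟩
    false                      ∎)

  ⊆-⊖-disjoint : ∀ {M S R : Subset n} → M ⊆ S → (∀ {i} → i ∈ M → i ∉ R) → M ⊆ S ⊖ R
  ⊆-⊖-disjoint {M} {S} {R} M⊆S M∩R=∅ {i} i∈M = lookup⇒[]= i _ (begin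
    lookup (S ⊖ R) i           ≡⟨ lookup-⊖ S R i ⟩
    lookup S i xor lookup R i  ≡⟨ cong₂ _xor_ ([]=⇒lookup (M⊆S i∈M)) (∉⇒lookup≡false (M∩R=∅ i∈M)) ⟩
    true                       ∎)

  ∁⁅x⁆⊖⁅x⁆≡⊤ : ∀ (x : Fin n) → ∁ ⁅ x ⁆ ⊖ ⁅ x ⁆ ≡ ⊤
  ∁⁅x⁆⊖⁅x⁆≡⊤ x = trans (cong (_⊖ ⁅ x ⁆) (∁≡⊤⊖ ⁅ x ⁆)) (⊖-cancelʳ ⊤ ⁅ x ⁆)

  ∁⁅x⁆⊖⊤≡⁅x⁆ : ∀ (x : Fin n) → ∁ ⁅ x ⁆ ⊖ ⊤ ≡ ⁅ x ⁆
  ∁⁅x⁆⊖⊤≡⁅x⁆ x = begin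
    ∁ ⁅ x ⁆ ⊖ ⊤      ≡⟨ cong (_⊖ ⊤) (∁≡⊤⊖ ⁅ x ⁆) ⟩
    (⊤ ⊖ ⁅ x ⁆) ⊖ ⊤  ≡⟨ ⊖-swapʳ ⊤ ⁅ x ⁆ ⊤ ⟩
    (⊤ ⊖ ⊤) ⊖ ⁅ x ⁆  ≡⟨ cong (_⊖ ⁅ x ⁆) (⊖-self ⊤) ⟩
    ⊥ ⊖ ⁅ x ⁆        ≡⟨ ⊖-identityˡ ⁅ x ⁆ ⟩
    ⁅ x ⁆            ∎

  ⊖⁅⁆-induction : ∀ {ℓ} (P : Subset n → Set ℓ) →
    (∀ S → (∀ x → x ∉ S → P (S ⊖ ⁅ x ⁆)) → P S) → ∀ S → P S
  ⊖⁅⁆-induction {ℓ} P extend = All.wfRec ⊃-wellFounded ℓ P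
    (λ S rec → extend S (λ x x∉S → rec (⊂-⊖⁅⁆ x∉S)))

  ⊖⁅⁆-injective : ∀ (S : Subset n) {x y} → S ⊖ ⁅ x ⁆ ≡ S ⊖ ⁅ y ⁆ → x ≡ y
  ⊖⁅⁆-injective S eq = ⁅⁆-injective (⊖-injectiveˡ S eq)

  gap-unique⇒≡∁⁅x⁆ : ∀ {S : Subset n} {x} → x ∉ S → (∀ y → y ∉ S → y ≡ x) → S ≡ ∁ ⁅ x ⁆
  gap-unique⇒≡∁⁅x⁆ {S} {x} x∉S unique = ⊆-antisym
    (λ {i} i∈S → x∉p⇒x∈∁p (x≢y⇒x∉⁅y⁆ λ { refl → x∉S i∈S }))
    (λ {i} i∈∁⁅x⁆ → case i ∈? S of λ
      { (yes i∈S) → i∈S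
      ; (no  i∉S) → contradiction (unique i i∉S) (x∉⁅y⁆⇒x≢y (x∈∁p⇒x∉p i∈∁⁅x⁆)) })

  ≢⇒∈∁⁅⁆ : ∀ {i x : Fin n} → i ≢ x → i ∈ ∁ ⁅ x ⁆
  ≢⇒∈∁⁅⁆ = x∉p⇒x∈∁p ∘ x≢y⇒x∉⁅y⁆

  ∈∁⁅⁆⇒≢ : ∀ {i x : Fin n} → i ∈ ∁ ⁅ x ⁆ → i ≢ x
  ∈∁⁅⁆⇒≢ = x∉⁅y⁆⇒x≢y ∘ x∈∁p⇒x∉p

∣p∣≡0⇒p≡⊥ : ∀ {n} (S : Subset n) → ∣ S ∣ ≡ 0 → S ≡ ⊥
∣p∣≡0⇒p≡⊥ []          _  = refl
∣p∣≡0⇒p≡⊥ (false ∷ S) eq = cong (false ∷_) (∣p∣≡0⇒p≡⊥ S eq)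

∣p∣≡1⇒p≡⁅x⁆ : ∀ {n} (S : Subset n) → ∣ S ∣ ≡ 1 → ∃ λ x → S ≡ ⁅ x ⁆
∣p∣≡1⇒p≡⁅x⁆ (true  ∷ S) eq = zero , cong (true ∷_) (∣p∣≡0⇒p≡⊥ S (suc-injective eq))
∣p∣≡1⇒p≡⁅x⁆ (false ∷ S) eq with x , S≡⁅x⁆ ← ∣p∣≡1⇒p≡⁅x⁆ S eq = suc x , cong (false ∷_) S≡⁅x⁆

⊆⇒≡⊎⊂ : ∀ {n} {S T : Subset n} → S ⊆ T → S ≡ T ⊎ S ⊂ T
⊆⇒≡⊎⊂ {S = S} {T} S⊆T with any? (λ x → x ∈? T ×-dec ¬? (x ∈? S))
... | yes (x , x∈T , x∉S) = inj₂ (S⊆T , x , x∈T , x∉S)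
... | no  T⊈S            = inj₁ (⊆-antisym S⊆T T⊆S)
  where
  T⊆S : T ⊆ S
  T⊆S {x} x∈T with x ∈? S
  ... | yes x∈S = x∈S
  ... | no  x∉S = contradiction (x , x∈T , x∉S) T⊈S

-- S ⊖ T ≡ ⁅ x ⁆ says that S — T is an edge of the hypercube on Subset n in direction x.
TARAdj⇔⊖≡⁅x⁆ : ∀ (X : VertexSetProperty) {n} {S T : Subset n} → TARAdj X S T ⇔ (∃ λ x → S ⊖ T ≡ ⁅ x ⁆)
TARAdj⇔⊖≡⁅x⁆ X {S = S} {T} = mk⇔ (∣p∣≡1⇒p≡⁅x⁆ (S ⊖ T)) (λ (x , eq) → trans (cong ∣_∣ eq) (∣⁅x⁆∣≡1 x))

⁅⁆⊖⁅⁆-pairs : ∀ {n} {p q r s : Fin n} → p ≢ q → q ≢ r → ⁅ p ⁆ ⊖ ⁅ q ⁆ ≡ ⁅ s ⁆ ⊖ ⁅ r ⁆ → p ≡ r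
⁅⁆⊖⁅⁆-pairs {p = p} {q} {r} {s} p≢q q≢r eq with p ≟ r
... | yes p≡r = p≡r
... | no  p≢r = contradiction (⁅⁆-injective (⊖-injectiveˡ ⁅ p ⁆ (trans eq (cong (λ z → ⁅ z ⁆ ⊖ ⁅ r ⁆) (sym p≡s))))) q≢r
  where
  p∈⁅s⁆ : p ∈ ⁅ s ⁆
  p∈⁅s⁆ = ∈-⊖⁅⁆⁻ p≢r (subst (p ∈_) eq (∈-⊖⁅⁆⁺ p≢q (x∈⁅x⁆ p)))
  p≡s : p ≡ s
  p≡s = x∈⁅y⁆⇒x≡y s p∈⁅s⁆

square-parallel : ∀ {n} {a b c d : Subset n} {p q r s} →
  a ⊖ b ≡ ⁅ p ⁆ → b ⊖ c ≡ ⁅ q ⁆ → d ⊖ c ≡ ⁅ r ⁆ → a ⊖ d ≡ ⁅ s ⁆ → a ≢ c → b ≢ d → p ≡ r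
square-parallel {a = a} {b} {c} {d} {p} {q} {r} {s} ab bc dc ad a≢c b≢d =
  ⁅⁆⊖⁅⁆-pairs p≢q q≢r (trans (sym ac) ac′)
  where
  ac : a ⊖ c ≡ ⁅ p ⁆ ⊖ ⁅ q ⁆
  ac = trans (sym (⊖-chain a b c)) (cong₂ _⊖_ ab bc)
  ac′ : a ⊖ c ≡ ⁅ s ⁆ ⊖ ⁅ r ⁆
  ac′ = trans (sym (⊖-chain a d c)) (cong₂ _⊖_ ad dc)
  bd : b ⊖ d ≡ ⁅ q ⁆ ⊖ ⁅ r ⁆
  bd = trans (sym (⊖-chain b c d)) (cong₂ _⊖_ bc (trans (⊖-comm c d) dc))
  p≢q : p ≢ q
  p≢q refl = a≢c (⊖≡⊥⇒≡ (trans ac (⊖-self ⁅ p ⁆)))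
  q≢r : q ≢ r
  q≢r refl = b≢d (⊖≡⊥⇒≡ (trans bd (⊖-self ⁅ q ⁆)))

-- Relabelling subsets along a permutation

module _ {n : ℕ} (ψ : Fin n ↔ Fin n) where
  open Inverse ψ using (to; from; strictlyInverseˡ; strictlyInverseʳ)

  lookup-image : ∀ S j → lookup (image ψ S) j ≡ lookup S (from j)
  lookup-image S j = lookup∘tabulate _ j

  ∈-image⁺ : ∀ {S i} → i ∈ S → to i ∈ image ψ S
  ∈-image⁺ {S} {i} i∈S = lookup⇒[]= (to i) _
    (trans (lookup-image S (to i)) (trans (cong (lookup S) (strictlyInverseʳ i)) ([]=⇒lookup i∈S)))

  ∈-image⁻ : ∀ {S j} → j ∈ image ψ S → from j ∈ S
  ∈-image⁻ {S} {j} j∈ = lookup⇒[]= (from j) S (trans (sym (lookup-image S j)) ([]=⇒lookup j∈))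

  image-mono : ∀ {S T} → S ⊆ T → image ψ S ⊆ image ψ T
  image-mono {S} {T} S⊆T {j} j∈ = subst (_∈ image ψ T) (strictlyInverseˡ j) (∈-image⁺ (S⊆T (∈-image⁻ j∈)))

  image-⊖ : ∀ S T → image ψ (S ⊖ T) ≡ image ψ S ⊖ image ψ T
  image-⊖ S T = lookup-ext λ j → begin
    lookup (image ψ (S ⊖ T)) j                      ≡⟨ lookup-image (S ⊖ T) j ⟩
    lookup (S ⊖ T) (from j)                         ≡⟨ lookup-⊖ S T (from j) ⟩
    lookup S (from j) xor lookup T (from j)         ≡⟨ cong₂ _xor_ (lookup-image S j) (lookup-image T j) ⟨
    lookup (image ψ S) j xor lookup (image ψ T) j   ≡⟨ lookup-⊖ (image ψ S) (image ψ T) j ⟨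
    lookup (image ψ S ⊖ image ψ T) j                ∎

  image-⊤ : image ψ ⊤ ≡ ⊤
  image-⊤ = ⊆-antisym ⊆⊤ (λ {j} _ → subst (_∈ image ψ ⊤) (strictlyInverseˡ j) (∈-image⁺ ∈⊤))

  image-⁅⁆ : ∀ x → image ψ ⁅ x ⁆ ≡ ⁅ to x ⁆
  image-⁅⁆ x = ⊆-antisym
    (λ {j} j∈ → subst (_∈ ⁅ to x ⁆) (trans (cong to (sym (x∈⁅y⁆⇒x≡y x (∈-image⁻ j∈)))) (strictlyInverseˡ j)) (x∈⁅x⁆ (to x)))
    (λ {j} j∈ → subst (_∈ image ψ ⁅ x ⁆) (sym (x∈⁅y⁆⇒x≡y (to x) j∈)) (∈-image⁺ (x∈⁅x⁆ x)))

  image⁻¹-image : ∀ S → image (↔-sym ψ) (image ψ S) ≡ S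
  image⁻¹-image S = lookup-ext λ i → begin
    lookup (image (↔-sym ψ) (image ψ S)) i  ≡⟨ lookup∘tabulate _ i ⟩
    lookup (image ψ S) (to i)               ≡⟨ lookup-image S (to i) ⟩
    lookup S (from (to i))                  ≡⟨ cong (lookup S) (strictlyInverseʳ i) ⟩
    lookup S i                              ∎

  image-image⁻¹ : ∀ S → image ψ (image (↔-sym ψ) S) ≡ S
  image-image⁻¹ S = lookup-ext λ j → begin
    lookup (image ψ (image (↔-sym ψ) S)) j  ≡⟨ lookup-image (image (↔-sym ψ) S) j ⟩
    lookup (image (↔-sym ψ) S) (from j)     ≡⟨ lookup∘tabulate _ (from j) ⟩
    lookup S (to (from j))                  ≡⟨ cong (lookup S) (strictlyInverseˡ j) ⟩
    lookup S j                              ∎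

  ∣image∣ : ∀ S → ∣ image ψ S ∣ ≡ ∣ S ∣
  ∣image∣ S = begin
    ∣ image ψ S ∣                               ≡⟨ ∣∣≡sum (image ψ S) ⟩
    sum (λ j → indicator (lookup (image ψ S) j))      ≡⟨ sum-cong-≗ (cong indicator ∘ lookup-image S) ⟩
    sum (λ j → indicator (lookup S (from j)))         ≡⟨ sum-permute (indicator ∘ lookup S) (↔-sym ψ) ⟨
    sum (λ i → indicator (lookup S i))                ≡⟨ ∣∣≡sum S ⟨
    ∣ S ∣                                       ∎
    where
    indicator : Bool → ℕ
    indicator true  = 1
    indicator false = 0
    ∣∣≡sum : ∀ {m} (S : Subset m) → ∣ S ∣ ≡ sum (indicator ∘ lookup S)
    ∣∣≡sum []          = refl
    ∣∣≡sum (true  ∷ S) = cong suc (∣∣≡sum S)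
    ∣∣≡sum (false ∷ S) = ∣∣≡sum S

-- Left inverses on a finite type are iterates

module _ {A : Set} {m : ℕ} (encode : A → Fin m) (encode-injective : ∀ {a b} → encode a ≡ encode b → a ≡ b)
         (g h : A → A) (h∘g≗id : ∀ a → h (g a) ≡ a) where

  private
    iterate-+ : ∀ a i k → iterate g a (i + k) ≡ iterate g (iterate g a i) k
    iterate-+ a zero    k = refl
    iterate-+ a (suc i) k = iterate-+ (g a) i k

    iterate-suc : ∀ a d → iterate g (g a) d ≡ g (iterate g a d)
    iterate-suc a zero    = refl
    iterate-suc a (suc d) = iterate-suc (g a) d

    iterate-cancel : ∀ i {a b} → iterate g a i ≡ iterate g b i → a ≡ b
    iterate-cancel zero    eq = eq
    iterate-cancel (suc i) {a} {b} eq =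
      trans (sym (h∘g≗id a)) (trans (cong h (iterate-cancel i eq)) (h∘g≗id b))

  -- By pigeonhole two of the first m + 1 iterates of a coincide, so a = g^(d+1) a for some d.
  left-inverse-is-iterate : ∀ a → ∃ λ d → h a ≡ iterate g a d
  left-inverse-is-iterate a
    with i , j , i<j , eq ← pigeonhole (n<1+n m) (λ k → encode (iterate g a (toℕ k)))
    with d , i+d≡j ← m≤n⇒∃[o]m+o≡n i<j
    = d , (begin
      h a                          ≡⟨ cong h a≡g[gᵈa] ⟩
      h (g (iterate g a d))        ≡⟨ h∘g≗id (iterate g a d) ⟩
      iterate g a d                ∎)
    where
    j≡1+d+i : toℕ j ≡ suc d + toℕ i
    j≡1+d+i = trans (sym i+d≡j) (cong suc (+-comm (toℕ i) d))
    a≡g[gᵈa] : a ≡ g (iterate g a d)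
    a≡g[gᵈa] = iterate-cancel (toℕ i) (begin
      iterate g a (toℕ i)                          ≡⟨ encode-injective eq ⟩
      iterate g a (toℕ j)                          ≡⟨ cong (iterate g a) j≡1+d+i ⟩
      iterate g a (suc d + toℕ i)                  ≡⟨ iterate-+ a (suc d) (toℕ i) ⟩
      iterate g (iterate g (g a) d) (toℕ i)        ≡⟨ cong (λ b → iterate g b (toℕ i)) (iterate-suc a d) ⟩
      iterate g (g (iterate g a d)) (toℕ i)        ∎)

  left-inverse-preserves : ∀ {ℓ} (P : A → Set ℓ) → (∀ a → P a → P (g a)) → ∀ a → P a → P (h a)
  left-inverse-preserves P g-preserves a Pa with d , ha≡gᵈa ← left-inverse-is-iterate a =
    subst P (sym ha≡gᵈa) (iterate-preserves d a Pa)
    where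
    iterate-preserves : ∀ d a → P a → P (iterate g a d)
    iterate-preserves zero    a Pa = Pa
    iterate-preserves (suc d) a Pa = iterate-preserves d (g a) (g-preserves a Pa)

private
  bit : Bool → Fin 2
  bit false = zero
  bit true  = suc zero

  bit-injective : ∀ {a b} → bit a ≡ bit b → a ≡ b
  bit-injective {false} {false} _ = refl
  bit-injective {true}  {true}  _ = refl

encode-subset : ∀ {n} → Subset n → Fin (2 ^ n)
encode-subset []      = zero
encode-subset (b ∷ S) = combine (bit b) (encode-subset S)

encode-subset-injective : ∀ {n} {S T : Subset n} → encode-subset S ≡ encode-subset T → S ≡ T
encode-subset-injective {S = []}    {[]}    _ = refl
encode-subset-injective {S = a ∷ S} {b ∷ T} eq
  with bit-eq , rest-eq ← combine-injective (bit a) (encode-subset S) (bit b) (encode-subset T) eq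
  = cong₂ _∷_ (bit-injective bit-eq) (encode-subset-injective rest-eq)

-- Walks and components

module _ {n : ℕ} {G : Graph n} where

  Reach-trans : ∀ {u v w} → Reach G u v → Reach G v w → Reach G u w
  Reach-trans here        r′ = r′
  Reach-trans (step uv r) r′ = step uv (Reach-trans r r′)

  Reach-sym : ∀ {u v} → Reach G u v → Reach G v u
  Reach-sym here                = here
  Reach-sym (step {u} {v} uv r) = Reach-trans (Reach-sym r) (step (trans (adj-sym G v u) uv) here)

  isolated-Reach : ∀ {x y} → IsolatedVertex G x → Reach G x y → y ≡ x
  isolated-Reach isolated here                = refl
  isolated-Reach isolated (step {v = v} xv _) with () ← trans (sym xv) (isolated v)

  component-Reach : ∀ {C} → IsComponent G C → ∀ {u w} → u ∈ C → w ∈ C → Reach G u w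
  component-Reach (v , spans) u∈C w∈C = Reach-trans (Reach-sym (proj₁ (spans _) u∈C)) (proj₁ (spans _) w∈C)

  component-closed : ∀ {C} → IsComponent G C → ∀ {u w} → u ∈ C → adj G u w ≡ true → w ∈ C
  component-closed (v , spans) u∈C uw = proj₂ (spans _) (Reach-trans (proj₁ (spans _) u∈C) (step uw here))

  induced-component-connected : ∀ {C} → IsComponent G C → ∀ {k} {H : Graph k} {e} → InducedOn G C H e → Connected H
  induced-component-connected {C} C-component {H = H} {e} (e-injective , e-onto , e-into , e-adj) i j =
    lift (component-Reach C-component (e-into i) (e-into j)) (e-into i) refl refl
    where
    lift : ∀ {u w} → Reach G u w → u ∈ C → ∀ {i j} → e i ≡ u → e j ≡ w → Reach H i j
    lift here _ ei≡u ej≡u = subst (Reach H _) (e-injective _ _ (trans ei≡u (sym ej≡u))) here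
    lift (step {v = v} uv r) u∈C {i} ei≡u ej≡w with l , el≡v ← e-onto v (component-closed C-component u∈C uv) =
      step (trans (e-adj i l) (trans (cong₂ (adj G) ei≡u el≡v) uv))
           (lift r (component-closed C-component u∈C uv) el≡v ej≡w)

module _ {k n : ℕ} (e : Fin k → Fin n) where

  ∈-preimage⁺ : ∀ {S i} → e i ∈ S → i ∈ preimage e S
  ∈-preimage⁺ {S} {i} ei∈S = lookup⇒[]= i _ (trans (lookup∘tabulate _ i) ([]=⇒lookup ei∈S))

  ∈-preimage⁻ : ∀ {S i} → i ∈ preimage e S → e i ∈ S
  ∈-preimage⁻ {S} {i} i∈ = lookup⇒[]= (e i) S (trans (sym (lookup∘tabulate _ i)) ([]=⇒lookup i∈))

  preimage-∁⁅⁆ : (∀ i j → e i ≡ e j → i ≡ j) → ∀ x → preimage e (∁ ⁅ e x ⁆) ≡ ∁ ⁅ x ⁆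
  preimage-∁⁅⁆ e-injective x = ⊆-antisym
    (λ i∈ → ≢⇒∈∁⁅⁆ (λ { refl → ∈∁⁅⁆⇒≢ (∈-preimage⁻ i∈) refl }))
    (λ i∈ → ∈-preimage⁺ (≢⇒∈∁⁅⁆ (∈∁⁅⁆⇒≢ i∈ ∘ e-injective _ x)))

suc-∣∁⁅x⁆∣ : ∀ {k} (x : Fin k) → suc ∣ ∁ ⁅ x ⁆ ∣ ≡ k
suc-∣∁⁅x⁆∣ {suc k} x = cong suc (trans (∣∁p∣≡n∸∣p∣ ⁅ x ⁆) (cong (suc k ∸_) (∣⁅x⁆∣≡1 x)))

distinct⇒2≤ : ∀ {k} {i j : Fin k} → i ≢ j → 2 ≤ k
distinct⇒2≤ {suc zero}    {zero} {zero} i≢j = contradiction refl i≢j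
distinct⇒2≤ {suc (suc k)}                _   = s≤s (s≤s z≤n)

inhabited⇒1≤ : ∀ {k} → Fin k → 1 ≤ k
inhabited⇒1≤ {suc _} _ = s≤s z≤n

-- X-sets and automorphisms of the X-TAR graph

module _ (X : VertexSetProperty) where

  inverse-TARAut : ∀ {n} {G : Graph n} {f} (A : IsTARAut X G f) → IsTARAut X G (IsTARAut.inv A)
  inverse-TARAut {f = f} A = record
    { maps    = invMaps
    ; inv     = f
    ; invMaps = maps
    ; invˡ    = invʳ
    ; invʳ    = invˡ
    ; adjPres = λ S T xS xT → mk⇔
        (λ adj → Equivalence.from (adjPres (inv S) (inv T) (invMaps S xS) (invMaps T xT))
                   (subst₂ (TARAdj X) (sym (invʳ S xS)) (sym (invʳ T xT)) adj))
        (λ adj → subst₂ (TARAdj X) (invʳ S xS) (invʳ T xT)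
                   (Equivalence.to (adjPres (inv S) (inv T) (invMaps S xS) (invMaps T xT)) adj))
    }
    where open IsTARAut A

  ⊤-XSet : RobustXSetParameter X → ∀ {n} (G : Graph n) → 1 ≤ n → IsXSet X G ⊤
  ⊤-XSet robust {n} G n≥1 with S , xS ← RobustXSetParameter.cohesive robust n n≥1 G =
    RobustXSetParameter.superset robust n n≥1 G S ⊤ xS ⊆⊤

  -- By isomorphism invariance, X(K₁) = 0 makes ⊥ an X-set of every one-vertex graph.
  subsingleton-all-XSets : RobustXSetParameter X → XNumber X K₁ 0 →
    ∀ {k} (H : Graph k) → Fin k → (∀ (i j : Fin k) → i ≡ j) → ∀ S → IsXSet X H S
  subsingleton-all-XSets robust ((S₀ , xS₀ , ∣S₀∣≡0) , _) {suc zero} H _ _ S =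
    superset 1 (s≤s z≤n) H ⊥ S x⊥ ⊥⊆
    where
    open RobustXSetParameter robust
    K₁≅H : ∀ S → X 1 K₁ S ≡ X 1 H (image (↔-id (Fin 1)) S)
    K₁≅H = isoInvariant 1 1 (s≤s z≤n) K₁ H (↔-id (Fin 1)) λ { zero zero → irrefl H zero }
    x⊥ : IsXSet X H ⊥
    x⊥ = begin
      X 1 H ⊥                          ≡⟨ cong (X 1 H) (trans (tabulate∘lookup S₀) (∣p∣≡0⇒p≡⊥ S₀ ∣S₀∣≡0)) ⟨
      X 1 H (image (↔-id (Fin 1)) S₀)  ≡⟨ K₁≅H S₀ ⟨
      X 1 K₁ S₀                        ≡⟨ xS₀ ⟩
      true                             ∎
  subsingleton-all-XSets _ _ {suc (suc _)} _ _ trivial _ with () ← trivial zero (suc zero)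

module XSets (X : VertexSetProperty) (robust : RobustXSetParameter X) {n : ℕ} (n≥1 : 1 ≤ n) (G : Graph n) where
  open RobustXSetParameter robust

  XSet-⊆ : ∀ {S S′} → IsXSet X G S → S ⊆ S′ → IsXSet X G S′
  XSet-⊆ {S} {S′} = superset n n≥1 G S S′

  XSet-⊤ : IsXSet X G ⊤
  XSet-⊤ = ⊤-XSet X robust G n≥1

  minimal-XSet-⊆ : ∀ {S} → IsXSet X G S → ∃ λ M → MinimalXSet X G M × M ⊆ S
  minimal-XSet-⊆ {S} = All.wfRec ⊂-wellFounded _ P below S
    where
    P : Subset n → Set
    P S = IsXSet X G S → ∃ λ M → MinimalXSet X G M × M ⊆ S
    below : ∀ S → (∀ {T} → T ⊂ S → P T) → P S
    below S rec xS with anySubset? (λ T → T ⊂? S ×-dec X n G T ≟ᵇ true)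
    ... | yes (T , T⊂S , xT) with M , minM , M⊆T ← rec T⊂S xT = M , minM , proj₁ T⊂S ∘ M⊆T
    ... | no  ∄T = S , (xS , minimal) , λ x∈S → x∈S
      where
      minimal : ∀ T → T ⊆ S → IsXSet X G T → T ≡ S
      minimal T T⊆S xT with ⊆⇒≡⊎⊂ T⊆S
      ... | inj₁ T≡S = T≡S
      ... | inj₂ T⊂S = contradiction (T , T⊂S , xT) ∄T

  minimal-XSet-⊖⁅⁆ : ∀ {M x} → MinimalXSet X G M → x ∈ M → ¬ IsXSet X G (M ⊖ ⁅ x ⁆)
  minimal-XSet-⊖⁅⁆ {M} {x} (_ , minimal) x∈M xM-x = x∉S⊖⁅x⁆ x∈M (subst (x ∈_) (sym M-x≡M) x∈M)
    where
    M-x⊆M : M ⊖ ⁅ x ⁆ ⊆ M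
    M-x⊆M {i} i∈ with i ≟ x
    ... | yes refl = contradiction i∈ (x∉S⊖⁅x⁆ x∈M)
    ... | no  i≢x  = ∈-⊖⁅⁆⁻ i≢x i∈
    M-x≡M : M ⊖ ⁅ x ⁆ ≡ M
    M-x≡M = minimal (M ⊖ ⁅ x ⁆) M-x⊆M xM-x

  ⊖-irrelevant-XSet : ∀ {R} → IrrelevantSet X G R → ∀ S → IsXSet X G S → IsXSet X G (S ⊖ R)
  ⊖-irrelevant-XSet irrelevant S xS with M , minM , M⊆S ← minimal-XSet-⊆ xS =
    XSet-⊆ (proj₁ minM) (⊆-⊖-disjoint M⊆S (λ {i} i∈M i∈R → irrelevant i i∈R M minM i∈M))

  ν-TARAut : ∀ R → IrrelevantSet X G R → IsTARAut X G (λ S → S ⊖ R)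
  ν-TARAut R irrelevant = record
    { maps    = ⊖-irrelevant-XSet irrelevant
    ; inv     = λ S → S ⊖ R
    ; invMaps = ⊖-irrelevant-XSet irrelevant
    ; invˡ    = λ S _ → ⊖-cancelʳ S R
    ; invʳ    = λ S _ → ⊖-cancelʳ S R
    ; adjPres = λ S T _ _ → mk⇔ (subst (λ D → ∣ D ∣ ≡ 1) (sym (⊖-⊖-cancel S T)))
                                (subst (λ D → ∣ D ∣ ≡ 1) (⊖-⊖-cancel S T))
    }
    where
    ⊖-⊖-cancel : ∀ S T → (S ⊖ R) ⊖ (T ⊖ R) ≡ S ⊖ T
    ⊖-⊖-cancel S T = begin
      (S ⊖ R) ⊖ (T ⊖ R)  ≡⟨ cong ((S ⊖ R) ⊖_) (⊖-comm T R) ⟩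
      (S ⊖ R) ⊖ (R ⊖ T)  ≡⟨ ⊖-chain S R T ⟩
      S ⊖ T              ∎

  image-XSet : ∀ {ψ} → InMX X G ψ → ∀ S → IsXSet X G S → IsXSet X G (image ψ S)
  image-XSet {ψ} ψ∈MX S xS with M , minM , M⊆S ← minimal-XSet-⊆ xS =
    XSet-⊆ (proj₁ (proj₁ (ψ∈MX M minM))) (image-mono ψ M⊆S)

  -- ψ⁻¹ is not known to lie in M_X(G), but image ψ⁻¹ is an iterate of image ψ.
  image⁻¹-XSet : ∀ {ψ} → InMX X G ψ → ∀ S → IsXSet X G S → IsXSet X G (image (↔-sym ψ) S)
  image⁻¹-XSet {ψ} ψ∈MX = left-inverse-preserves (encode-subset {n}) encode-subset-injective
    (image ψ) (image (↔-sym ψ)) (image⁻¹-image ψ) (IsXSet X G) (image-XSet {ψ} ψ∈MX)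

  image-TARAut : ∀ ψ → InMX X G ψ → IsTARAut X G (image ψ)
  image-TARAut ψ ψ∈MX = record
    { maps    = image-XSet {ψ} ψ∈MX
    ; inv     = image (↔-sym ψ)
    ; invMaps = image⁻¹-XSet {ψ} ψ∈MX
    ; invˡ    = λ S _ → image⁻¹-image ψ S
    ; invʳ    = λ S _ → image-image⁻¹ ψ S
    ; adjPres = λ S T _ _ → mk⇔ (trans (∣image-⊖∣ S T)) (trans (sym (∣image-⊖∣ S T)))
    }
    where
    ∣image-⊖∣ : ∀ S T → ∣ image ψ S ⊖ image ψ T ∣ ≡ ∣ S ⊖ T ∣
    ∣image-⊖∣ S T = trans (cong ∣_∣ (sym (image-⊖ ψ S T))) (∣image∣ ψ (S ⊖ T))

  InMX-if-image-preserves-XSets : ∀ ψ →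
    (∀ S → IsXSet X G S → IsXSet X G (image ψ S)) →
    (∀ S → IsXSet X G S → IsXSet X G (image (↔-sym ψ) S)) → InMX X G ψ
  InMX-if-image-preserves-XSets ψ forward backward M (xM , minimal) = (forward M xM , minimal′) , ∣image∣ ψ M
    where
    minimal′ : ∀ T → T ⊆ image ψ M → IsXSet X G T → T ≡ image ψ M
    minimal′ T T⊆ψM xT = begin
      T                             ≡⟨ image-image⁻¹ ψ T ⟨
      image ψ (image (↔-sym ψ) T)   ≡⟨ cong (image ψ) (minimal (image (↔-sym ψ) T) ψ⁻¹T⊆M (backward T xT)) ⟩
      image ψ M                     ∎
      where
      ψ⁻¹T⊆M : image (↔-sym ψ) T ⊆ M
      ψ⁻¹T⊆M = subst (image (↔-sym ψ) T ⊆_) (image⁻¹-image ψ M) (image-mono (↔-sym ψ) T⊆ψM)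

  component-cosingleton-XSet : XNumber X K₁ 0 ⊎ NoIsolatedVertices G →
    ∀ {C} → IsComponent G C → ∀ {k} {H : Graph k} {e} → InducedOn G C H e → ∀ i → IsXSet X H (∁ ⁅ i ⁆)
  component-cosingleton-XSet hyp {C} C-component {k} {H} {e} induced@(e-injective , e-onto , e-into , _) i
    with any? (λ u → adj G (e i) u ≟ᵇ true)
  ... | yes (u , xu) with j , ej≡u ← e-onto u (component-closed C-component (e-into i) xu) =
    n-1-set k (distinct⇒2≤ i≢j) H (induced-component-connected C-component induced) (∁ ⁅ i ⁆) (suc-∣∁⁅x⁆∣ i)
    where
    i≢j : i ≢ j
    i≢j refl with () ← trans (sym (irrefl G (e i))) (subst (λ w → adj G (e i) w ≡ true) (sym ej≡u) xu)
  ... | no ∄u = case hyp of λ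
    { (inj₁ X[K₁]≡0)    → subsingleton-all-XSets X robust X[K₁]≡0 H i H-trivial (∁ ⁅ i ⁆)
    ; (inj₂ no-isolated) → contradiction isolated (no-isolated (e i)) }
    where
    isolated : IsolatedVertex G (e i)
    isolated u with adj G (e i) u in xu
    ... | true  = contradiction (u , xu) ∄u
    ... | false = refl
    e≡ei : ∀ j → e j ≡ e i
    e≡ei j = isolated-Reach isolated (component-Reach C-component (e-into i) (e-into j))
    H-trivial : ∀ j j′ → j ≡ j′
    H-trivial j j′ = e-injective j j′ (trans (e≡ei j) (sym (e≡ei j′)))

  cosingleton-XSet : XNumber X K₁ 0 ⊎ NoIsolatedVertices G → ∀ x → IsXSet X G (∁ ⁅ x ⁆)
  cosingleton-XSet hyp x = Equivalence.from (componentConsistency n n≥1 G (∁ ⁅ x ⁆)) per-component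
    where
    per-component : ∀ C → IsComponent G C → ∀ k (H : Graph k) e →
                    InducedOn G C H e → IsXSet X H (preimage e (∁ ⁅ x ⁆))
    per-component C C-component@(v , spans) k H e induced@(e-injective , e-onto , e-into , _) with x ∈? C
    ... | yes x∈C with i , ei≡x ← e-onto x x∈C =
      subst (IsXSet X H) (sym (trans (cong (λ y → preimage e (∁ ⁅ y ⁆)) (sym ei≡x)) (preimage-∁⁅⁆ e e-injective i)))
        (component-cosingleton-XSet hyp C-component induced i)
    ... | no  x∉C = superset k k≥1 H ⊤ _ (⊤-XSet X robust H k≥1)
                      (λ {i} _ → ∈-preimage⁺ e (≢⇒∈∁⁅⁆ λ ei≡x → x∉C (subst (_∈ C) ei≡x (e-into i))))
      where
      k≥1 : 1 ≤ k
      k≥1 = inhabited⇒1≤ (proj₁ (e-onto v (proj₂ (spans v) here)))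

  module Directions {f} (A : IsTARAut X G f) (cosingleton-XSet : ∀ x → IsXSet X G (∁ ⁅ x ⁆)) where
    open IsTARAut A

    f-injective : ∀ {S T} → IsXSet X G S → IsXSet X G T → f S ≡ f T → S ≡ T
    f-injective {S} {T} xS xT eq = trans (sym (invˡ S xS)) (trans (cong inv eq) (invˡ T xT))

    f-edge : ∀ {S T x} → IsXSet X G S → IsXSet X G T → S ⊖ T ≡ ⁅ x ⁆ → ∃ λ y → f S ⊖ f T ≡ ⁅ y ⁆
    f-edge {S} {T} xS xT S⊖T = Equivalence.to (TARAdj⇔⊖≡⁅x⁆ X)
      (Equivalence.to (adjPres S T xS xT) (Equivalence.from (TARAdj⇔⊖≡⁅x⁆ X) (_ , S⊖T)))

    direction : Fin n → Fin n
    direction x = proj₁ (f-edge (cosingleton-XSet x) XSet-⊤ (∁⁅x⁆⊖⊤≡⁅x⁆ x))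

    direction-spec : ∀ x → f (∁ ⁅ x ⁆) ⊖ f ⊤ ≡ ⁅ direction x ⁆
    direction-spec x = proj₂ (f-edge (cosingleton-XSet x) XSet-⊤ (∁⁅x⁆⊖⊤≡⁅x⁆ x))

    -- For x ∉ S, S ⊖ ⁅ x ⁆ is S ∪ {x}. Induct downwards from ∁ ⁅ x ⁆; each step closes the square
    -- S, S ∪ {x}, S ∪ {x, y}, S ∪ {y} of X-sets, whose image has parallel opposite edges.
    direction-⊖⁅⁆ : ∀ S → IsXSet X G S → ∀ x → x ∉ S → f S ⊖ f (S ⊖ ⁅ x ⁆) ≡ ⁅ direction x ⁆
    direction-⊖⁅⁆ = ⊖⁅⁆-induction P extend
      where
      P : Subset n → Set
      P S = IsXSet X G S → ∀ x → x ∉ S → f S ⊖ f (S ⊖ ⁅ x ⁆) ≡ ⁅ direction x ⁆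
      extend : ∀ S → (∀ y → y ∉ S → P (S ⊖ ⁅ y ⁆)) → P S
      extend S ih xS x x∉S with any? (λ y → ¬? (y ∈? S) ×-dec ¬? (y ≟ x))
      ... | no ∄y = begin
        f S ⊖ f (S ⊖ ⁅ x ⁆)                  ≡⟨ cong (λ T → f T ⊖ f (T ⊖ ⁅ x ⁆)) S≡∁⁅x⁆ ⟩
        f (∁ ⁅ x ⁆) ⊖ f (∁ ⁅ x ⁆ ⊖ ⁅ x ⁆)    ≡⟨ cong (λ T → f (∁ ⁅ x ⁆) ⊖ f T) (∁⁅x⁆⊖⁅x⁆≡⊤ x) ⟩
        f (∁ ⁅ x ⁆) ⊖ f ⊤                    ≡⟨ direction-spec x ⟩
        ⁅ direction x ⁆                      ∎
        where
        S≡∁⁅x⁆ : S ≡ ∁ ⁅ x ⁆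
        S≡∁⁅x⁆ = gap-unique⇒≡∁⁅x⁆ x∉S λ y y∉S → case y ≟ x of λ
          { (yes y≡x) → y≡x
          ; (no  y≢x) → contradiction (y , y∉S , y≢x) ∄y }
      ... | yes (y , y∉S , y≢x) =
        trans (proj₂ ab) (cong ⁅_⁆ (square-parallel (proj₂ ab) (proj₂ bc) dc (proj₂ ad) a≢c b≢d))
        where
        Sx Sy Sxy : Subset n
        Sx  = S ⊖ ⁅ x ⁆
        Sy  = S ⊖ ⁅ y ⁆
        Sxy = Sx ⊖ ⁅ y ⁆
        y∉Sx : y ∉ Sx
        y∉Sx = y∉S ∘ ∈-⊖⁅⁆⁻ y≢x
        x∉Sy : x ∉ Sy
        x∉Sy = x∉S ∘ ∈-⊖⁅⁆⁻ (y≢x ∘ sym)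
        xSx : IsXSet X G Sx
        xSx = XSet-⊆ xS (⊆-⊖⁅⁆ x∉S)
        xSy : IsXSet X G Sy
        xSy = XSet-⊆ xS (⊆-⊖⁅⁆ y∉S)
        xSxy : IsXSet X G Sxy
        xSxy = XSet-⊆ xSx (⊆-⊖⁅⁆ y∉Sx)
        ab : ∃ λ p → f S ⊖ f Sx ≡ ⁅ p ⁆
        ab = f-edge xS xSx (⊖-cancelˡ S ⁅ x ⁆)
        bc : ∃ λ q → f Sx ⊖ f Sxy ≡ ⁅ q ⁆
        bc = f-edge xSx xSxy (⊖-cancelˡ Sx ⁅ y ⁆)
        ad : ∃ λ s → f S ⊖ f Sy ≡ ⁅ s ⁆
        ad = f-edge xS xSy (⊖-cancelˡ S ⁅ y ⁆)
        dc : f Sy ⊖ f Sxy ≡ ⁅ direction x ⁆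
        dc = subst (λ T → f Sy ⊖ f T ≡ ⁅ direction x ⁆) (sym (⊖-swapʳ S ⁅ x ⁆ ⁅ y ⁆)) (ih y y∉S xSy x x∉Sy)
        a≢c : f S ≢ f Sxy
        a≢c eq = y≢x (⊖⁅⁆-injective S (trans (cong (_⊖ ⁅ y ⁆) (f-injective xS xSxy eq)) (⊖-cancelʳ Sx ⁅ y ⁆)))
        b≢d : f Sx ≢ f Sy
        b≢d eq = y≢x (sym (⊖⁅⁆-injective S (f-injective xSx xSy eq)))

    direction-edge : ∀ {S T x} → IsXSet X G S → IsXSet X G T → S ⊖ T ≡ ⁅ x ⁆ → f S ⊖ f T ≡ ⁅ direction x ⁆
    direction-edge {S} {T} {x} xS xT S⊖T with x ∈? S
    ... | no  x∉S = subst (λ T → f S ⊖ f T ≡ ⁅ direction x ⁆) (sym (⊖≡⇒≡⊖ S⊖T)) (direction-⊖⁅⁆ S xS x x∉S)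
    ... | yes x∈S = trans (⊖-comm (f S) (f T))
                      (subst (λ S → f T ⊖ f S ≡ ⁅ direction x ⁆) (sym S≡T⊖⁅x⁆) (direction-⊖⁅⁆ T xT x x∉T))
      where
      x∉T : x ∉ T
      x∉T = subst (x ∉_) (sym (⊖≡⇒≡⊖ S⊖T)) (x∉S⊖⁅x⁆ x∈S)
      S≡T⊖⁅x⁆ : S ≡ T ⊖ ⁅ x ⁆
      S≡T⊖⁅x⁆ = ⊖≡⇒≡⊖ (trans (⊖-comm T S) S⊖T)

  module Structure {f} (A : IsTARAut X G f) (cosingleton-XSet : ∀ x → IsXSet X G (∁ ⁅ x ⁆)) where
    open IsTARAut A
    module F   = Directions A cosingleton-XSet
    module F⁻¹ = Directions (inverse-TARAut X A) cosingleton-XSet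

    π π⁻¹ : Fin n → Fin n
    π   = F.direction
    π⁻¹ = F⁻¹.direction

    π⁻¹∘π : ∀ x → π⁻¹ (π x) ≡ x
    π⁻¹∘π x = ⁅⁆-injective (begin
      ⁅ π⁻¹ (π x) ⁆                    ≡⟨ F⁻¹.direction-edge (maps _ (cosingleton-XSet x)) (maps ⊤ XSet-⊤) (F.direction-spec x) ⟨
      inv (f (∁ ⁅ x ⁆)) ⊖ inv (f ⊤)    ≡⟨ cong₂ _⊖_ (invˡ _ (cosingleton-XSet x)) (invˡ ⊤ XSet-⊤) ⟩
      ∁ ⁅ x ⁆ ⊖ ⊤                      ≡⟨ ∁⁅x⁆⊖⊤≡⁅x⁆ x ⟩
      ⁅ x ⁆                            ∎)

    π∘π⁻¹ : ∀ x → π (π⁻¹ x) ≡ x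
    π∘π⁻¹ x = ⁅⁆-injective (begin
      ⁅ π (π⁻¹ x) ⁆                    ≡⟨ F.direction-edge (invMaps _ (cosingleton-XSet x)) (invMaps ⊤ XSet-⊤) (F⁻¹.direction-spec x) ⟨
      f (inv (∁ ⁅ x ⁆)) ⊖ f (inv ⊤)    ≡⟨ cong₂ _⊖_ (invʳ _ (cosingleton-XSet x)) (invʳ ⊤ XSet-⊤) ⟩
      ∁ ⁅ x ⁆ ⊖ ⊤                      ≡⟨ ∁⁅x⁆⊖⊤≡⁅x⁆ x ⟩
      ⁅ x ⁆                            ∎)

    Π : Fin n ↔ Fin n
    Π = mk↔ₛ′ π π⁻¹ π∘π⁻¹ π⁻¹∘π

    T : Subset n
    T = ⊤ ⊖ f ⊤

    f≡image⊖T : ∀ S → IsXSet X G S → f S ≡ image Π S ⊖ T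
    f≡image⊖T = ⊖⁅⁆-induction P extend
      where
      P : Subset n → Set
      P S = IsXSet X G S → f S ≡ image Π S ⊖ T
      extend : ∀ S → (∀ x → x ∉ S → P (S ⊖ ⁅ x ⁆)) → P S
      extend S ih xS with any? (λ x → ¬? (x ∈? S))
      ... | no ∄x = begin
        f S             ≡⟨ cong f S≡⊤ ⟩
        f ⊤             ≡⟨ ⊖-cancelˡ ⊤ (f ⊤) ⟨
        ⊤ ⊖ T           ≡⟨ cong (_⊖ T) (trans (cong (image Π) S≡⊤) (image-⊤ Π)) ⟨
        image Π S ⊖ T   ∎
        where
        S≡⊤ : S ≡ ⊤
        S≡⊤ = ⊆-antisym ⊆⊤ λ {x} _ → case x ∈? S of λ
          { (yes x∈S) → x∈S
          ; (no  x∉S) → contradiction (x , x∉S) ∄x }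
      ... | yes (x , x∉S) = begin
        f S                                       ≡⟨ ⊖≡⇒≡⊖ (trans (⊖-comm (f Sx) (f S)) (F.direction-⊖⁅⁆ S xS x x∉S)) ⟩
        f Sx ⊖ ⁅ π x ⁆                            ≡⟨ cong (_⊖ ⁅ π x ⁆) (ih x x∉S xSx) ⟩
        (image Π Sx ⊖ T) ⊖ ⁅ π x ⁆                ≡⟨ cong (λ D → (D ⊖ T) ⊖ ⁅ π x ⁆) image-Sx ⟩
        ((image Π S ⊖ ⁅ π x ⁆) ⊖ T) ⊖ ⁅ π x ⁆     ≡⟨ cong (_⊖ ⁅ π x ⁆) (⊖-swapʳ (image Π S) ⁅ π x ⁆ T) ⟩
        ((image Π S ⊖ T) ⊖ ⁅ π x ⁆) ⊖ ⁅ π x ⁆     ≡⟨ ⊖-cancelʳ (image Π S ⊖ T) ⁅ π x ⁆ ⟩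
        image Π S ⊖ T                             ∎
        where
        Sx : Subset n
        Sx = S ⊖ ⁅ x ⁆
        xSx : IsXSet X G Sx
        xSx = XSet-⊆ xS (⊆-⊖⁅⁆ x∉S)
        image-Sx : image Π Sx ≡ image Π S ⊖ ⁅ π x ⁆
        image-Sx = trans (image-⊖ Π S ⁅ x ⁆) (cong (image Π S ⊖_) (image-⁅⁆ Π x))

    image≡f⊖T : ∀ S → IsXSet X G S → image Π S ≡ f S ⊖ T
    image≡f⊖T S xS = trans (sym (⊖-cancelʳ (image Π S) T)) (cong (_⊖ T) (sym (f≡image⊖T S xS)))

    -- Toggling π⁻¹ t in the preimage of M removes t from M, leaving an X-set inside M.
    T-irrelevant : IrrelevantSet X G T
    T-irrelevant t t∈T M minM t∈M = minimal-XSet-⊖⁅⁆ minM t∈M (subst (IsXSet X G) fZ′≡M-t (maps Z′ xZ′))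
      where
      Z : Subset n
      Z = inv M
      xZ : IsXSet X G Z
      xZ = invMaps M (proj₁ minM)
      t∉image-Z : t ∉ image Π Z
      t∉image-Z = subst (t ∉_) (sym (trans (image≡f⊖T Z xZ) (cong (_⊖ T) (invʳ M (proj₁ minM))))) (∈-⊖-both t∈M t∈T)
      π⁻¹t∉Z : π⁻¹ t ∉ Z
      π⁻¹t∉Z π⁻¹t∈Z = t∉image-Z (subst (_∈ image Π Z) (π∘π⁻¹ t) (∈-image⁺ Π π⁻¹t∈Z))
      Z′ : Subset n
      Z′ = Z ⊖ ⁅ π⁻¹ t ⁆
      xZ′ : IsXSet X G Z′
      xZ′ = XSet-⊆ xZ (⊆-⊖⁅⁆ π⁻¹t∉Z)
      fZ′≡M-t : f Z′ ≡ M ⊖ ⁅ t ⁆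
      fZ′≡M-t = begin
        f Z′                                 ≡⟨ f≡image⊖T Z′ xZ′ ⟩
        image Π Z′ ⊖ T                       ≡⟨ cong (_⊖ T) (image-⊖ Π Z ⁅ π⁻¹ t ⁆) ⟩
        (image Π Z ⊖ image Π ⁅ π⁻¹ t ⁆) ⊖ T  ≡⟨ cong (λ D → (image Π Z ⊖ D) ⊖ T) (trans (image-⁅⁆ Π (π⁻¹ t)) (cong ⁅_⁆ (π∘π⁻¹ t))) ⟩
        (image Π Z ⊖ ⁅ t ⁆) ⊖ T              ≡⟨ ⊖-swapʳ (image Π Z) ⁅ t ⁆ T ⟩
        (image Π Z ⊖ T) ⊖ ⁅ t ⁆              ≡⟨ cong (_⊖ ⁅ t ⁆) (f≡image⊖T Z xZ) ⟨
        f Z ⊖ ⁅ t ⁆                          ≡⟨ cong (_⊖ ⁅ t ⁆) (invʳ M (proj₁ minM)) ⟩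
        M ⊖ ⁅ t ⁆                            ∎

    Π∈MX : InMX X G Π
    Π∈MX = InMX-if-image-preserves-XSets Π forward backward
      where
      forward : ∀ S → IsXSet X G S → IsXSet X G (image Π S)
      forward S xS = subst (IsXSet X G) (sym (image≡f⊖T S xS)) (⊖-irrelevant-XSet T-irrelevant (f S) (maps S xS))
      backward : ∀ S → IsXSet X G S → IsXSet X G (image (↔-sym Π) S)
      backward S xS = subst (IsXSet X G) (sym image⁻¹S≡Z) xZ
        where
        xS⊖T : IsXSet X G (S ⊖ T)
        xS⊖T = ⊖-irrelevant-XSet T-irrelevant S xS
        Z : Subset n
        Z = inv (S ⊖ T)
        xZ : IsXSet X G Z
        xZ = invMaps (S ⊖ T) xS⊖T
        image⁻¹S≡Z : image (↔-sym Π) S ≡ Z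
        image⁻¹S≡Z = begin
          image (↔-sym Π) S                   ≡⟨ cong (image (↔-sym Π)) (⊖-cancelʳ S T) ⟨
          image (↔-sym Π) ((S ⊖ T) ⊖ T)       ≡⟨ cong (λ D → image (↔-sym Π) (D ⊖ T)) (invʳ (S ⊖ T) xS⊖T) ⟨
          image (↔-sym Π) (f Z ⊖ T)           ≡⟨ cong (image (↔-sym Π)) (image≡f⊖T Z xZ) ⟨
          image (↔-sym Π) (image Π Z)         ≡⟨ image⁻¹-image Π Z ⟩
          Z                                   ∎

    f-as-word : ∃ λ (w : List (Generator X G)) → ∀ S → IsXSet X G S → f S ≡ evalWord X w S
    f-as-word = (ν T T-irrelevant ∷ ψ⁺ Π Π∈MX ∷ []) , f≡image⊖T

theorem2p30 : (X : VertexSetProperty) → RobustXSetParameter X →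
    ∀ n → 1 ≤ n → (G : Graph n) →
    (XNumber X K₁ 0 ⊎ NoIsolatedVertices G) →
    (∀ R → IrrelevantSet X G R → IsTARAut X G (λ S → S ⊖ R)) ×
    (∀ ψ → InMX X G ψ → IsTARAut X G (image ψ)) ×
    (∀ f → IsTARAut X G f →
      ∃ λ (w : List (Generator X G)) → ∀ S → IsXSet X G S → f S ≡ evalWord X w S)
theorem2p30 X robust n n≥1 G hyp =
  ν-TARAut , image-TARAut , λ f A → Structure.f-as-word A (cosingleton-XSet hyp)
  where open XSets X robust n≥1 G
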